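{- Let $N\ge1$ and $r\ge 0$ be integers. Let $q\subseteq[N]\times[N]$ and let $P$ be a proper pairing of $q$. Then $q\in\mathcal W(r)$ if and only if there exists a nimple graph $G$ with at most $N$ vertices which has a trail double cover consisting of exactly $r$ closed walks and such that $(q,P)\in c(G)$.
   Context: $[N]=\{1,\dots,N\}$; elements of $[N]\times[N]$ are directed edges of the complete directed graph $D$ on $[N]$ (loops included). A closed trail in $D$ is a cyclic sequence of pairwise distinct directed edges $(a_1,\dots,a_k)$, $k\ge1$, such that the head of each $a_t$ is the tail of $a_{t+1}$ (indices mod $k$). $\mathcal W(r)$ is the set of all subsets of $[N]\times[N]$ that can be partitioned into $r$ edge-disjoint closed trails ($\mathcal W(0)=\{\emptyset\}$). A proper pairing of $q\subseteq[N]\times[N]$ is a partition of $q$ into pairs $\{(i,j),(j,i)\}$ of two distinct elements of $q$. A graph is nimple if it is simple (no loops, no multiple edges) and has no vertex of degree $0$. A trail double cover (TDC) of a graph $G$ is a collection of closed walks in $G$, each of positive length, such that every edge $\{x,y\}$ of $G$ is traversed exactly twice in total by these walks, once from $x$ to $y$ and once from $y$ to $x$. For a nimple graph $G$ with at most $N$ vertices, $c(G)$ is the set of all pairs $(q,P)$ for which there is an injective map $d:V(G)\to[N]$ with $q=\{(d(x),d(y)),(d(y),d(x)):\{x,y\}\in E(G)\}$ and $P=\{\{(d(x),d(y)),(d(y),d(x))\}:\{x,y\}\in E(G)\}$. -}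

module Defs where

open import Data.Nat using (ℕ; _≤_)
open import Data.Fin using (Fin; _≟_)
open import Data.Bool using (Bool; true; false)
open import Data.Product using (Σ; ∃; ∃-syntax; ∃!; _×_; _,_; proj₁; proj₂; swap)
open import Data.Product.Properties using (≡-dec)
open import Data.List using (List; []; _∷_; concat; map; allFin; filter; length)
open import Data.List.Relation.Unary.All using (All)
open import Data.List.Relation.Unary.Unique.Propositional using (Unique)
open import Data.List.Membership.Propositional using (_∈_; _∉_)
open import Data.Empty using (⊥)
open import Relation.Binary.PropositionalEquality using (_≡_; _≢_)
open import Function.Definitions using (Injective)
open import Function.Bundles using (_⇔_)

-- directed edges of the complete directed digraph D on [N] (loops included);
-- [N] is modelled by Fin N; an edge (i , j) has tail i and head j.
Edge : ℕ → Set
Edge N = Fin N × Fin N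

-- a list of arcs a₁ … a_k (k ≥ 1) in which the head of each a_t is the tail
-- of a_{t+1}, indices mod k (i.e. a cyclic sequence given by a representative).
closesAt : {V : Set} → V → V × V → List (V × V) → Set
closesAt s c []       = proj₂ c ≡ s
closesAt s c (b ∷ bs) = (proj₂ c ≡ proj₁ b) × closesAt s b bs

IsClosedSeq : {V : Set} → List (V × V) → Set
IsClosedSeq []       = ⊥
IsClosedSeq (a ∷ as) = closesAt (proj₁ a) a as

ClosedTrail : (N : ℕ) → List (Edge N) → Set
ClosedTrail N t = IsClosedSeq t × Unique t

-- subsets of [N]×[N] are Boolean-valued functions.
-- W(r): q can be partitioned into r edge-disjoint closed trails.
InW : (N r : ℕ) → (Edge N → Bool) → Set
InW N r q =
  Σ (Fin r → List (Edge N)) λ ts →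
    (∀ i → ClosedTrail N (ts i)) ×
    (∀ i j → i ≢ j → ∀ e → e ∈ ts i → e ∉ ts j) ×
    (∀ e → (q e ≡ true) ⇔ (∃[ i ] (e ∈ ts i)))

-- A set P of unordered pairs of edges is encoded as a symmetric relation
-- P e f (meaning {e , f} ∈ P).  Proper pairing of q.
ProperPairing : {N : ℕ} → (Edge N → Bool) → (Edge N → Edge N → Bool) → Set
ProperPairing {N} q P =
  (∀ e f → P e f ≡ P f e) ×
  (∀ e f → P e f ≡ true → (q e ≡ true) × (q f ≡ true) × (e ≢ f) × (f ≡ swap e)) ×
  (∀ e → q e ≡ true → ∃! _≡_ (λ f → P e f ≡ true))

Nimple : {n : ℕ} → (Fin n → Fin n → Bool) → Set
Nimple {n} adj =
  (∀ x → adj x x ≡ false) ×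
  (∀ x y → adj x y ≡ adj y x) ×
  (∀ x → ∃[ y ] (adj x y ≡ true))

ClosedWalk : {n : ℕ} → (Fin n → Fin n → Bool) → List (Fin n × Fin n) → Set
ClosedWalk adj w = IsClosedSeq w × All (λ a → adj (proj₁ a) (proj₂ a) ≡ true) w

traversals : {n r : ℕ} → (Fin r → List (Fin n × Fin n)) → Fin n × Fin n → ℕ
traversals {n} {r} ws a = length (filter (λ b → ≡-dec _≟_ _≟_ b a) (concat (map ws (allFin r))))

HasTDC : {n : ℕ} → (Fin n → Fin n → Bool) → ℕ → Set
HasTDC {n} adj r =
  Σ (Fin r → List (Fin n × Fin n)) λ ws →
    (∀ i → ClosedWalk adj (ws i)) ×
    (∀ x y → adj x y ≡ true → traversals ws (x , y) ≡ 1 × traversals ws (y , x) ≡ 1)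

InC : {N n : ℕ} → (Fin n → Fin n → Bool) → (Edge N → Bool) → (Edge N → Edge N → Bool) → Set
InC {N} {n} adj q P =
  Σ (Fin n → Fin N) λ d →
    Injective _≡_ _≡_ d ×
    (∀ e → (q e ≡ true) ⇔ (∃[ x ] ∃[ y ] ((adj x y ≡ true) × (e ≡ (d x , d y))))) ×
    (∀ e f → (P e f ≡ true) ⇔
      (∃[ x ] ∃[ y ] ((adj x y ≡ true) × (e ≡ (d x , d y)) × (f ≡ (d y , d x)))))

module Submission where

-- Both sides say that q splits into r closed sequences using every arc of q exactly once: the
-- trails of W(r), and the closed walks of a trail double cover, whose arcs are pairwise distinct
-- because each is traversed once.  Such decompositions transfer in both directions along an
-- injective vertex map d: images of walks are trails, and conversely every arc of q joins two
-- vertices of the graph spanned by q, so trails lift to walks.  That graph is nimple because a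
-- proper pairing forces q to be symmetric and loopless, and P is then necessarily e ↦ swap e.

open import Defs
open import Data.Nat using (ℕ; _≤_; zero; suc; z≤n; s≤s; s≤s⁻¹)
open import Data.Nat.Properties using (≤-trans; ≤-reflexive; n≤1+n)
open import Data.Fin using (Fin; zero; suc; _≟_)
import Data.Fin.Properties as Fin
open import Data.Bool using (Bool; true; false)
import Data.Bool as Bool
open import Data.Bool.Properties using (¬-not)
open import Data.Product using (Σ; ∃-syntax; _×_; _,_; proj₁; proj₂; swap; uncurry)
open import Data.Product.Properties using (≡-dec)
open import Data.List using (List; []; _∷_; _++_; concat; map; tabulate; allFin; filter; length; lookup)
open import Data.List.Properties using (map-tabulate; tabulate-cong; concat-map; length-filter; length-tabulate)
open import Data.List.Relation.Unary.All as All using (All; []; _∷_)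
import Data.List.Relation.Unary.All.Properties as All
open import Data.List.Relation.Unary.Any using (here; there; index)
open import Data.List.Relation.Unary.Any.Properties using (lookup-index)
import Data.List.Relation.Unary.AllPairs.Properties as AllPairs
open import Data.List.Relation.Unary.Unique.Propositional using (Unique; []; _∷_)
import Data.List.Relation.Unary.Unique.Propositional.Properties as Unique
open import Data.List.Relation.Binary.Disjoint.Propositional using (Disjoint)
open import Data.List.Membership.Propositional using (_∈_; _∉_)
open import Data.List.Membership.Propositional.Properties
  using (∈-map⁺; ∈-map⁻; ∈-concat⁺′; ∈-concat⁻′; ∈-tabulate⁺; ∈-tabulate⁻; ∈-filter⁺; ∈-filter⁻; ∈-allFin; ∈-lookup)
open import Relation.Nullary using (yes; no; contradiction)
open import Relation.Binary.PropositionalEquality using (_≡_; _≢_; refl; sym; trans; cong; cong₂; subst)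
open import Function using (_∘_)
open import Function.Definitions using (Injective)
open import Function.Bundles using (_⇔_; mk⇔; Equivalence)
import Function.Properties.Equivalence as ⇔

occurrences : {m : ℕ} → Edge m → List (Edge m) → ℕ
occurrences a xs = length (filter (λ b → ≡-dec _≟_ _≟_ b a) xs)

module _ {m : ℕ} where

  occurrences-∷-≤ : (a b : Edge m) (xs : List (Edge m)) → occurrences a xs ≤ occurrences a (b ∷ xs)
  occurrences-∷-≤ a b xs with ≡-dec _≟_ _≟_ b a
  ... | yes _ = n≤1+n _
  ... | no _  = ≤-reflexive refl

  occurrences-self : (a : Edge m) (xs : List (Edge m)) → occurrences a (a ∷ xs) ≡ suc (occurrences a xs)
  occurrences-self a xs with ≡-dec _≟_ _≟_ a a
  ... | yes _   = refl
  ... | no a≢a = contradiction refl a≢a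

  ∈⇒1≤occurrences : {a : Edge m} {xs : List (Edge m)} → a ∈ xs → 1 ≤ occurrences a xs
  ∈⇒1≤occurrences {a} {b ∷ xs} a∈ with ≡-dec _≟_ _≟_ b a | a∈
  ... | yes _   | _        = s≤s z≤n
  ... | no b≢a | here a≡b = contradiction (sym a≡b) b≢a
  ... | no _   | there a∈ = ∈⇒1≤occurrences a∈

  1≤occurrences⇒∈ : {a : Edge m} {xs : List (Edge m)} → 1 ≤ occurrences a xs → a ∈ xs
  1≤occurrences⇒∈ {a} {b ∷ xs} h with ≡-dec _≟_ _≟_ b a
  ... | yes b≡a = here (sym b≡a)
  ... | no _    = there (1≤occurrences⇒∈ h)

  ∉⇒occurrences≡0 : {a : Edge m} {xs : List (Edge m)} → a ∉ xs → occurrences a xs ≡ 0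
  ∉⇒occurrences≡0 {a} {[]}     _  = refl
  ∉⇒occurrences≡0 {a} {b ∷ xs} a∉ with ≡-dec _≟_ _≟_ b a
  ... | yes b≡a = contradiction (here (sym b≡a)) a∉
  ... | no _    = ∉⇒occurrences≡0 (a∉ ∘ there)

  Unique⇒occurrences≡1 : {a : Edge m} {xs : List (Edge m)} → Unique xs → a ∈ xs → occurrences a xs ≡ 1
  Unique⇒occurrences≡1 {a} {b ∷ xs} (b∉xs ∷ u) a∈ with ≡-dec _≟_ _≟_ b a | a∈
  ... | yes refl | _        = cong suc (∉⇒occurrences≡0 (λ b∈ → All.lookup b∉xs b∈ refl))
  ... | no b≢a   | here a≡b = contradiction (sym a≡b) b≢a
  ... | no _     | there a∈ = Unique⇒occurrences≡1 u a∈

  occurrences≤1⇒Unique : {xs : List (Edge m)} → (∀ a → a ∈ xs → occurrences a xs ≤ 1) → Unique xs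
  occurrences≤1⇒Unique {[]}     _ = []
  occurrences≤1⇒Unique {b ∷ xs} h = All.tabulate b∉xs ∷ occurrences≤1⇒Unique tail
    where
    b∉xs : ∀ {c} → c ∈ xs → b ≢ c
    b∉xs c∈ refl = contradiction (≤-trans (∈⇒1≤occurrences c∈) (s≤s⁻¹ b-once)) λ ()
      where
      b-once : suc (occurrences b xs) ≤ 1
      b-once = subst (_≤ 1) (occurrences-self b xs) (h b (here refl))
    tail : ∀ a → a ∈ xs → occurrences a xs ≤ 1
    tail a a∈ = ≤-trans (occurrences-∷-≤ a b xs) (h a (there a∈))

⋃ : {A : Set} {r : ℕ} → (Fin r → List A) → List A
⋃ ts = concat (tabulate ts)

PairwiseDisjoint : {A : Set} {r : ℕ} → (Fin r → List A) → Set
PairwiseDisjoint ts = ∀ i j → i ≢ j → ∀ e → e ∈ ts i → e ∉ ts j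

module _ {A : Set} where

  ∈-⋃⁺ : {r : ℕ} (ts : Fin r → List A) (i : Fin r) {e : A} → e ∈ ts i → e ∈ ⋃ ts
  ∈-⋃⁺ ts i e∈ = ∈-concat⁺′ e∈ (∈-tabulate⁺ i)

  ∈-⋃⁻ : {r : ℕ} (ts : Fin r → List A) {e : A} → e ∈ ⋃ ts → ∃[ i ] (e ∈ ts i)
  ∈-⋃⁻ ts e∈ with ∈-concat⁻′ (tabulate ts) e∈
  ... | _ , e∈xs , xs∈ with ∈-tabulate⁻ xs∈
  ...   | i , refl = i , e∈xs

  ∈-⋃ : {r : ℕ} (ts : Fin r → List A) {e : A} → (e ∈ ⋃ ts) ⇔ (∃[ i ] (e ∈ ts i))
  ∈-⋃ ts = mk⇔ (∈-⋃⁻ ts) (λ (i , e∈) → ∈-⋃⁺ ts i e∈)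

  ⋃-map : {B : Set} {r : ℕ} (f : A → B) (ts : Fin r → List A) → ⋃ (map f ∘ ts) ≡ map f (⋃ ts)
  ⋃-map f ts = trans (cong concat (sym (map-tabulate ts (map f)))) (concat-map (tabulate ts))

  Unique-++⁻ : (xs : List A) {ys : List A} → Unique (xs ++ ys) → Unique xs × Unique ys × Disjoint xs ys
  Unique-++⁻ []       u = [] , u , λ ()
  Unique-++⁻ (x ∷ xs) (x∉ ∷ u) with Unique-++⁻ xs u
  ... | uxs , uys , xs#ys = All.++⁻ˡ xs x∉ ∷ uxs , uys , disjoint
    where
    disjoint : Disjoint (x ∷ xs) _
    disjoint (here refl , v∈ys) = All.lookup (All.++⁻ʳ xs x∉) v∈ys refl
    disjoint (there v∈xs , v∈ys) = xs#ys (v∈xs , v∈ys)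

  Unique-⋃⁺ : {r : ℕ} (ts : Fin r → List A) → (∀ i → Unique (ts i)) → PairwiseDisjoint ts → Unique (⋃ ts)
  Unique-⋃⁺ ts u dj =
    Unique.concat⁺ (All.tabulate⁺ u) (AllPairs.tabulate⁺ (λ i≢j (e∈ , e∈′) → dj _ _ i≢j _ e∈ e∈′))

  Unique-⋃⁻ : {r : ℕ} (ts : Fin r → List A) → Unique (⋃ ts) → (∀ i → Unique (ts i)) × PairwiseDisjoint ts
  Unique-⋃⁻ {zero}  ts _ = (λ ()) , λ ()
  Unique-⋃⁻ {suc r} ts u with Unique-++⁻ (ts zero) u
  ... | u₀ , u₊ , ts₀#rest with Unique-⋃⁻ (ts ∘ suc) u₊
  ...   | us , dj = unique , disjoint
    where
    unique : ∀ i → Unique (ts i)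
    unique zero    = u₀
    unique (suc i) = us i
    disjoint : PairwiseDisjoint ts
    disjoint zero    zero    0≢0 = contradiction refl 0≢0
    disjoint zero    (suc j) _   e e∈₀ e∈ⱼ = ts₀#rest (e∈₀ , ∈-⋃⁺ (ts ∘ suc) j e∈ⱼ)
    disjoint (suc i) zero    _   e e∈ᵢ e∈₀ = ts₀#rest (e∈₀ , ∈-⋃⁺ (ts ∘ suc) i e∈ᵢ)
    disjoint (suc i) (suc j) i≢j = dj i j (i≢j ∘ cong suc)

  lookup-injective : {xs : List A} → Unique xs → Injective _≡_ _≡_ (lookup xs)
  lookup-injective {x ∷ xs} _        {zero}  {zero}  _  = refl
  lookup-injective {x ∷ xs} (x∉ ∷ _) {zero}  {suc j} eq = contradiction eq (All.lookup x∉ (∈-lookup j))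
  lookup-injective {x ∷ xs} (x∉ ∷ _) {suc i} {zero}  eq = contradiction (sym eq) (All.lookup x∉ (∈-lookup i))
  lookup-injective {x ∷ xs} (_ ∷ u)  {suc i} {suc j} eq = cong suc (lookup-injective u eq)

traversals≡occurrences-⋃ : {n r : ℕ} (ws : Fin r → List (Edge n)) (a : Edge n) →
                           traversals ws a ≡ occurrences a (⋃ ws)
traversals≡occurrences-⋃ ws a = cong (occurrences a ∘ concat) (map-tabulate (λ i → i) ws)

mapArc : {V W : Set} → (V → W) → V × V → W × W
mapArc h (x , y) = h x , h y

module _ {V W : Set} (h : V → W) where

  closesAt-map⁺ : ∀ {s c} bs → closesAt s c bs → closesAt (h s) (mapArc h c) (map (mapArc h) bs)
  closesAt-map⁺ []       e         = cong h e
  closesAt-map⁺ (b ∷ bs) (e , rest) = cong h e , closesAt-map⁺ bs rest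

  closesAt-map⁻ : Injective _≡_ _≡_ h →
                  ∀ {s c} bs → closesAt (h s) (mapArc h c) (map (mapArc h) bs) → closesAt s c bs
  closesAt-map⁻ h-inj []       e         = h-inj e
  closesAt-map⁻ h-inj (b ∷ bs) (e , rest) = h-inj e , closesAt-map⁻ h-inj bs rest

  IsClosedSeq-map⁺ : (t : List (V × V)) → IsClosedSeq t → IsClosedSeq (map (mapArc h) t)
  IsClosedSeq-map⁺ (a ∷ as) = closesAt-map⁺ as

  IsClosedSeq-map⁻ : Injective _≡_ _≡_ h → (t : List (V × V)) → IsClosedSeq (map (mapArc h) t) → IsClosedSeq t
  IsClosedSeq-map⁻ h-inj (a ∷ as) = closesAt-map⁻ h-inj as

  mapArc-injective : Injective _≡_ _≡_ h → Injective _≡_ _≡_ (mapArc h)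
  mapArc-injective h-inj {x , y} {x′ , y′} eq = cong₂ _,_ (h-inj (cong proj₁ eq)) (h-inj (cong proj₂ eq))

map-preimage : {A B : Set} {f : A → B} {ys : List B} → All (λ y → ∃[ x ] (f x ≡ y)) ys → ∃[ xs ] (map f xs ≡ ys)
map-preimage []               = [] , refl
map-preimage ((x , refl) ∷ ps) = let xs , eq = map-preimage ps in x ∷ xs , cong (_ ∷_) eq

IsExactCover : {A : Set} {r : ℕ} → (A → Bool) → (Fin r → List A) → Set
IsExactCover q ts = Unique (⋃ ts) × (∀ e → (q e ≡ true) ⇔ (e ∈ ⋃ ts))

ClosedDecomposition : {V : Set} {r : ℕ} → (V × V → Bool) → (Fin r → List (V × V)) → Set
ClosedDecomposition q ts = (∀ i → IsClosedSeq (ts i)) × IsExactCover q ts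

InW⇔ClosedDecomposition : (N r : ℕ) (q : Edge N → Bool) → InW N r q ⇔ (∃[ ts ] ClosedDecomposition q ts)
InW⇔ClosedDecomposition N r q = mk⇔ to from
  where
  to : InW N r q → ∃[ ts ] ClosedDecomposition q ts
  to (ts , trail , dj , cover) =
    ts , proj₁ ∘ trail , Unique-⋃⁺ ts (proj₂ ∘ trail) dj , λ e → ⇔.trans (cover e) (⇔.sym (∈-⋃ ts))
  from : ∃[ ts ] ClosedDecomposition q ts → InW N r q
  from (ts , closed , u , cover) =
    let unique , dj = Unique-⋃⁻ ts u in
    ts , (λ i → closed i , unique i) , dj , λ e → ⇔.trans (cover e) (∈-⋃ ts)

module _ {n r : ℕ} {adj : Fin n → Fin n → Bool} where

  HasTDC⇒ClosedDecomposition : HasTDC adj r → ∃[ ws ] ClosedDecomposition (uncurry adj) ws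
  HasTDC⇒ClosedDecomposition (ws , walk , double) = ws , proj₁ ∘ walk , unique , cover
    where
    arc-adj : ∀ {a} → a ∈ ⋃ ws → uncurry adj a ≡ true
    arc-adj a∈ = let i , a∈ᵢ = ∈-⋃⁻ ws a∈ in All.lookup (proj₂ (walk i)) a∈ᵢ
    once : ∀ a → uncurry adj a ≡ true → occurrences a (⋃ ws) ≡ 1
    once (x , y) xy = trans (sym (traversals≡occurrences-⋃ ws (x , y))) (proj₁ (double x y xy))
    unique : Unique (⋃ ws)
    unique = occurrences≤1⇒Unique (λ a a∈ → ≤-reflexive (once a (arc-adj a∈)))
    cover : ∀ a → (uncurry adj a ≡ true) ⇔ (a ∈ ⋃ ws)
    cover a = mk⇔ (λ h → 1≤occurrences⇒∈ (≤-reflexive (sym (once a h)))) arc-adj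

  ClosedDecomposition⇒HasTDC : (∀ x y → adj x y ≡ adj y x) → {ws : Fin r → List (Edge n)} →
                               ClosedDecomposition (uncurry adj) ws → HasTDC adj r
  ClosedDecomposition⇒HasTDC adj-sym {ws} (closed , u , cover) = ws , walk , double
    where
    walk : ∀ i → ClosedWalk adj (ws i)
    walk i = closed i , All.tabulate (λ {a} a∈ → Equivalence.from (cover a) (∈-⋃⁺ ws i a∈))
    once : ∀ a → uncurry adj a ≡ true → traversals ws a ≡ 1
    once a h = trans (traversals≡occurrences-⋃ ws a) (Unique⇒occurrences≡1 u (Equivalence.to (cover a) h))
    double : ∀ x y → adj x y ≡ true → traversals ws (x , y) ≡ 1 × traversals ws (y , x) ≡ 1
    double x y xy = once (x , y) xy , once (y , x) (trans (adj-sym y x) xy)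

ArcImage : {n N : ℕ} → (Fin n → Fin n → Bool) → (Fin n → Fin N) → Edge N → Set
ArcImage adj d e = ∃[ x ] ∃[ y ] ((adj x y ≡ true) × (e ≡ (d x , d y)))

PairImage : {n N : ℕ} → (Fin n → Fin n → Bool) → (Fin n → Fin N) → Edge N → Edge N → Set
PairImage adj d e f = ∃[ x ] ∃[ y ] ((adj x y ≡ true) × (e ≡ (d x , d y)) × (f ≡ (d y , d x)))

module Embedding {n N : ℕ} {adj : Fin n → Fin n → Bool} {q : Edge N → Bool}
  {d : Fin n → Fin N} (d-injective : Injective _≡_ _≡_ d)
  (q-image : ∀ e → (q e ≡ true) ⇔ ArcImage adj d e) where

  private
    d-arc-injective : Injective _≡_ _≡_ (mapArc d)
    d-arc-injective = mapArc-injective d d-injective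

    adj⇒q : ∀ {a} → uncurry adj a ≡ true → q (mapArc d a) ≡ true
    adj⇒q {x , y} xy = Equivalence.from (q-image _) (x , y , xy , refl)

    q⇒adj : ∀ {a} → q (mapArc d a) ≡ true → uncurry adj a ≡ true
    q⇒adj {a} qa with Equivalence.to (q-image _) qa
    ... | x , y , xy , eq = subst (λ b → uncurry adj b ≡ true) (d-arc-injective (sym eq)) xy

  module _ {r : ℕ} {ws : Fin r → List (Edge n)} {ts : Fin r → List (Edge N)}
           (image : ∀ i → map (mapArc d) (ws i) ≡ ts i) where

    ⋃-image : map (mapArc d) (⋃ ws) ≡ ⋃ ts
    ⋃-image = trans (sym (⋃-map (mapArc d) ws)) (cong concat (tabulate-cong image))

    ExactCover-image : IsExactCover (uncurry adj) ws ⇔ IsExactCover q ts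
    ExactCover-image = mk⇔ to from
      where
      to : IsExactCover (uncurry adj) ws → IsExactCover q ts
      to (u , cover) = subst Unique ⋃-image (Unique.map⁺ d-arc-injective u) , λ e → mk⇔ (into e) (onto e)
        where
        into : ∀ e → q e ≡ true → e ∈ ⋃ ts
        into e qe with Equivalence.to (q-image e) qe
        ... | x , y , xy , refl = subst (_ ∈_) ⋃-image (∈-map⁺ (mapArc d) (Equivalence.to (cover _) xy))
        onto : ∀ e → e ∈ ⋃ ts → q e ≡ true
        onto e e∈ with ∈-map⁻ (mapArc d) (subst (e ∈_) (sym ⋃-image) e∈)
        ... | a , a∈ , refl = adj⇒q (Equivalence.from (cover a) a∈)
      from : IsExactCover q ts → IsExactCover (uncurry adj) ws
      from (u , cover) = Unique.map⁻ (subst Unique (sym ⋃-image) u) , λ a → mk⇔ (into a) (onto a)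
        where
        into : ∀ a → uncurry adj a ≡ true → a ∈ ⋃ ws
        into a h with ∈-map⁻ (mapArc d) (subst (_ ∈_) (sym ⋃-image)
                                           (Equivalence.to (cover _) (adj⇒q h)))
        ... | a′ , a′∈ , eq = subst (_∈ ⋃ ws) (sym (d-arc-injective eq)) a′∈
        onto : ∀ a → a ∈ ⋃ ws → uncurry adj a ≡ true
        onto a a∈ = q⇒adj (Equivalence.from (cover _) (subst (_ ∈_) ⋃-image (∈-map⁺ (mapArc d) a∈)))

    ClosedDecomposition-image : ClosedDecomposition (uncurry adj) ws ⇔ ClosedDecomposition q ts
    ClosedDecomposition-image = mk⇔
      (λ (closed , cover) → (λ i → subst IsClosedSeq (image i) (IsClosedSeq-map⁺ d (ws i) (closed i))) ,
                             Equivalence.to ExactCover-image cover)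
      (λ (closed , cover) →
         (λ i → IsClosedSeq-map⁻ d d-injective (ws i) (subst IsClosedSeq (sym (image i)) (closed i))) ,
                             Equivalence.from ExactCover-image cover)

module Pairing {N : ℕ} {q : Edge N → Bool} {P : Edge N → Edge N → Bool} (pairing : ProperPairing q P) where

  private
    valid : ∀ e f → P e f ≡ true → (q e ≡ true) × (q f ≡ true) × (e ≢ f) × (f ≡ swap e)
    valid = proj₁ (proj₂ pairing)

  P⇔swap : ∀ e f → (P e f ≡ true) ⇔ ((q e ≡ true) × (f ≡ swap e))
  P⇔swap e f = mk⇔ (λ Pef → let qe , _ , _ , f≡ = valid e f Pef in qe , f≡) from
    where
    from : (q e ≡ true) × (f ≡ swap e) → P e f ≡ true
    from (qe , refl) = let f′ , Pef′ , _ = proj₂ (proj₂ pairing) e qe ; _ , _ , _ , f′≡ = valid e f′ Pef′ in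
                       subst (λ g → P e g ≡ true) f′≡ Pef′

  q-swap : ∀ {e} → q e ≡ true → q (swap e) ≡ true
  q-swap {e} qe = proj₁ (proj₂ (valid e (swap e) (Equivalence.from (P⇔swap e (swap e)) (qe , refl))))

  q-irreflexive : ∀ {v} → q (v , v) ≢ true
  q-irreflexive {v} qvv =
    let _ , _ , v≢v , _ = valid (v , v) (v , v) (Equivalence.from (P⇔swap _ _) (qvv , refl)) in v≢v refl

  P-image : {n : ℕ} {adj : Fin n → Fin n → Bool} {d : Fin n → Fin N} →
            (∀ e → (q e ≡ true) ⇔ ArcImage adj d e) → ∀ e f → (P e f ≡ true) ⇔ PairImage adj d e f
  P-image q-image e f = mk⇔ to from
    where
    to : P e f ≡ true → PairImage _ _ e f
    to Pef with Equivalence.to (P⇔swap e f) Pef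
    ... | qe , refl with Equivalence.to (q-image e) qe
    ...   | x , y , xy , refl = x , y , xy , refl , refl
    from : PairImage _ _ e f → P e f ≡ true
    from (x , y , xy , refl , refl) =
      Equivalence.from (P⇔swap _ _) (Equivalence.from (q-image _) (x , y , xy , refl) , refl)

true⇔true⇒≡ : {b c : Bool} → (b ≡ true → c ≡ true) → (c ≡ true → b ≡ true) → b ≡ c
true⇔true⇒≡ {false} {false} _   _   = refl
true⇔true⇒≡ {false} {true}  _   c⇒b = c⇒b refl
true⇔true⇒≡ {true}          b⇒c _   = sym (b⇒c refl)

module UnderlyingGraph {N : ℕ} (q : Edge N → Bool)
  (q-swap : ∀ {e} → q e ≡ true → q (swap e) ≡ true) (q-irreflexive : ∀ {v} → q (v , v) ≢ true) where

  vertices : List (Fin N)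
  vertices = filter (λ v → Fin.any? (λ u → q (v , u) Bool.≟ true)) (allFin N)

  n : ℕ
  n = length vertices

  n≤N : n ≤ N
  n≤N = ≤-trans (length-filter _ (allFin N)) (≤-reflexive (length-tabulate (λ i → i)))

  ∈-vertices : ∀ {v u} → q (v , u) ≡ true → v ∈ vertices
  ∈-vertices vu = ∈-filter⁺ _ (∈-allFin _) (_ , vu)

  embed : Fin n → Fin N
  embed = lookup vertices

  embed-injective : Injective _≡_ _≡_ embed
  embed-injective = lookup-injective (Unique.filter⁺ _ (Unique.allFin⁺ N))

  embed-index : ∀ {v} (v∈ : v ∈ vertices) → embed (index v∈) ≡ v
  embed-index v∈ = sym (lookup-index v∈)

  adj : Fin n → Fin n → Bool
  adj x y = q (embed x , embed y)

  lift : ∀ {e} → q e ≡ true → ∃[ a ] (mapArc embed a ≡ e)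
  lift {v , u} vu = (index (∈-vertices vu) , index (∈-vertices (q-swap vu))) ,
                    cong₂ _,_ (embed-index (∈-vertices vu)) (embed-index (∈-vertices (q-swap vu)))

  q-image : ∀ e → (q e ≡ true) ⇔ ArcImage adj embed e
  q-image e = mk⇔ to (λ (_ , _ , xy , e≡) → subst (λ e → q e ≡ true) (sym e≡) xy)
    where
    to : q e ≡ true → ArcImage adj embed e
    to qe = let (x , y) , eq = lift qe in x , y , subst (λ e → q e ≡ true) (sym eq) qe , sym eq

  adj-symmetric : ∀ x y → adj x y ≡ adj y x
  adj-symmetric x y = true⇔true⇒≡ q-swap q-swap

  nimple : Nimple adj
  nimple = (λ x → ¬-not q-irreflexive) , adj-symmetric , neighbour
    where
    neighbour : ∀ x → ∃[ y ] (adj x y ≡ true)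
    neighbour x with ∈-filter⁻ _ {xs = allFin N} (∈-lookup {xs = vertices} x)
    ... | _ , u , xu = index (∈-vertices (q-swap xu)) ,
                      subst (λ w → q (embed x , w) ≡ true) (sym (embed-index (∈-vertices (q-swap xu)))) xu

embeddedTDC⇒InW : {N n r : ℕ} {q : Edge N → Bool} {P : Edge N → Edge N → Bool} {adj : Fin n → Fin n → Bool} →
                  HasTDC adj r → InC adj q P → InW N r q
embeddedTDC⇒InW {N} {r = r} {q} tdc (d , d-injective , q-image , _) with HasTDC⇒ClosedDecomposition tdc
... | ws , decomposition =
  Equivalence.from (InW⇔ClosedDecomposition N r q)
    (map (mapArc d) ∘ ws , Equivalence.to (ClosedDecomposition-image (λ _ → refl)) decomposition)
  where open Embedding d-injective q-image

InW⇒embeddedTDC : {N r : ℕ} {q : Edge N → Bool} {P : Edge N → Edge N → Bool} → ProperPairing q P → InW N r q →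
                  ∃[ n ] ((n ≤ N) × (Σ (Fin n → Fin n → Bool) λ adj → Nimple adj × HasTDC adj r × InC adj q P))
InW⇒embeddedTDC {N} {r} {q} pairing w with Equivalence.to (InW⇔ClosedDecomposition N r q) w
... | ts , decomposition =
  n , n≤N , adj , nimple , ClosedDecomposition⇒HasTDC adj-symmetric lifted-decomposition ,
  embed , embed-injective , q-image , P-image q-image
  where
  open Pairing pairing
  open UnderlyingGraph q q-swap q-irreflexive
  open Embedding embed-injective q-image
  lifted : ∀ i → ∃[ ws ] (map (mapArc embed) ws ≡ ts i)
  lifted i = map-preimage (All.tabulate (λ {e} e∈ →
    lift (Equivalence.from (proj₂ (proj₂ decomposition) e) (∈-⋃⁺ ts i e∈))))
  lifted-decomposition : ClosedDecomposition (uncurry adj) (proj₁ ∘ lifted)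
  lifted-decomposition = Equivalence.from (ClosedDecomposition-image (proj₂ ∘ lifted)) decomposition

proposition3p3 : (N : ℕ) → 1 ≤ N → (r : ℕ) →
    (q : Edge N → Bool) → (P : Edge N → Edge N → Bool) → ProperPairing q P →
    InW N r q ⇔
      (∃[ n ] ((n ≤ N) × (Σ (Fin n → Fin n → Bool) λ adj →
        Nimple adj × HasTDC adj r × InC adj q P)))
proposition3p3 N _ r q P pairing =
  mk⇔ (InW⇒embeddedTDC pairing) (λ (_ , _ , _ , _ , tdc , embedding) → embeddedTDC⇒InW tdc embedding)
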